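{- Let $n\ge4$ and let $h$ be even with $h\ge\frac{2(n-1)}{n-3}$. Then there exists $p\in\mathcal{P}$ such that $D_{\mu(p)}(p)=D_{\mu(p^r)}(p^r)=\{n\}$.
   Context: $N=\{1,\dots,n\}$, $H=\{1,\dots,h\}$ with $h\ge2$, $\mathcal{P}=\mathcal{L}(N)^h$ the set of profiles of linear orders on $N$; $x>_{p_i}y$ means individual $i$ ranks $x$ above $y$; $p^r$ is the profile in which every individual's order is reversed. For integers $\mu$ with $h/2<\mu\le h$, $D_\mu(p)=\{x\in N:\forall y\in N,\ |\{i: y>_{p_i}x\}|<\mu\}$, and $\mu(p)=\min\{\mu\in\mathbb{N}\cap(h/2,h]: D_\mu(p)\ne\varnothing\}$ (well defined). -}

module Defs where

open import Data.Nat using (ℕ; zero; suc; _+_; _*_; _<_; _≤_)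
open import Data.Fin using (Fin; zero; suc; fromℕ) renaming (_<_ to _<ᶠ_)
open import Data.Fin.Permutation using (Permutation′; _⟨$⟩ʳ_; _∘ₚ_; reverse)
open import Data.Product using (Σ; _×_; ∃)
open import Relation.Nullary using (Dec; yes; no)
open import Relation.Nullary.Decidable using (⌊_⌋)
open import Data.Bool using (Bool; true; false; if_then_else_)

-- A linear order on N = Fin n, represented by the rank map σ : alternatives → positions
-- (position 0 = top).  x >_σ y  iff  x is ranked strictly above y.
LinOrd : ℕ → Set
LinOrd n = Permutation′ n

_≻[_]_ : ∀ {n} → Fin n → LinOrd n → Fin n → Set
x ≻[ σ ] y = (σ ⟨$⟩ʳ x) <ᶠ (σ ⟨$⟩ʳ y)

≻-dec : ∀ {n} (σ : LinOrd n) (x y : Fin n) → Dec (x ≻[ σ ] y)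
≻-dec σ x y = (σ ⟨$⟩ʳ x) Data.Fin.<? (σ ⟨$⟩ʳ y)

revOrd : ∀ {n} → LinOrd n → LinOrd n
revOrd σ = σ ∘ₚ reverse

Profile : ℕ → ℕ → Set
Profile n h = Fin h → LinOrd n

revProfile : ∀ {n h} → Profile n h → Profile n h
revProfile p i = revOrd (p i)

countH : ∀ {h} → (Fin h → Bool) → ℕ
countH {zero} f = 0
countH {suc h} f = (if f zero then 1 else 0) + countH (λ i → f (suc i))

support : ∀ {n h} → Profile n h → Fin n → Fin n → ℕ
support p y x = countH (λ i → ⌊ ≻-dec (p i) y x ⌋)

InD : ∀ {n h} → ℕ → Profile n h → Fin n → Set
InD μ p x = ∀ y → support p y x < μ

Admissible : ℕ → ℕ → Set
Admissible h μ = (h < 2 * μ) × (μ ≤ h)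

IsMu : ∀ {n h} → Profile n h → ℕ → Set
IsMu {n} {h} p m =
  Admissible h m × ∃ (λ x → InD m p x) ×
  (∀ m′ → Admissible h m′ → ∃ (λ x → InD m′ p x) → m ≤ m′)

-- Call a profile pivotal at c with margin k when c is tied k : k with every other
-- alternative, while every other alternative is beaten by some alternative, and beats
-- some alternative, with more than k votes. If h = 2k, every admissible μ exceeds k,
-- so μ(p) = k + 1 and D_{k+1}(p) = {c}; reversal swaps "is beaten" with "beats", so
-- the same holds for p^r. Pivotality survives adding a pair of mutually reversed
-- orders (k and h/2 grow by one) and cloning an alternative other than c into a new
-- one that everybody ranks immediately below it (n grows by one). The starting points
-- are Condorcet cycles on the other alternatives, with c on top in half of the orders
-- and at the bottom in the other half: n = 4, h = 6 and n = 5, h = 4. These reach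
-- every n ≥ 4 and even h with h (n - 3) ≥ 2 (n - 1).
module Submission where

open import Defs
open import Data.Nat using (ℕ; zero; suc; _+_; _*_; _∸_; _≤_; _<_; s≤s; s≤s⁻¹; z≤n; _<?_)
open import Data.Nat.Divisibility using (_∣_; divides)
import Data.Nat.Properties as ℕ
open import Data.Fin using (Fin; zero; suc; fromℕ; toℕ; opposite; punchIn)
import Data.Fin as F
import Data.Fin.Properties as FP
open import Data.Fin.Patterns using (0F; 1F; 3F; 4F)
open import Data.Fin.Permutation using (Permutation′; _⟨$⟩ʳ_; _⟨$⟩ˡ_; _∘ₚ_; insert)
import Data.Fin.Permutation as Perm
open import Data.Vec.Functional using ([]; _∷_)
open import Data.Product using (Σ; _×_; ∃; _,_)
open import Data.Sum using (inj₁; inj₂; _⊎_)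
open import Data.Bool using (Bool; true; false; if_then_else_)
open import Data.Empty using (⊥-elim)
open import Function using (_∘_)
open import Function.Bundles using (_⇔_; mk⇔; Equivalence)
open import Relation.Binary.Definitions using (tri<; tri≈; tri>)
open import Relation.Binary.PropositionalEquality
  using (_≡_; _≢_; refl; sym; trans; cong; cong₂; subst)
open import Relation.Nullary using (¬_; Dec; yes; no; ¬?; _×-dec_; _→-dec_)
open import Relation.Nullary.Decidable
  using (⌊_⌋; map′; from-yes; dec-true; dec-false; does-⇔; isYes≗does)

open Equivalence using (to; from)

private
  variable
    n h k : ℕ
    c : Fin n

⟨$⟩ʳ-injective : (σ : Permutation′ n) {x y : Fin n} → σ ⟨$⟩ʳ x ≡ σ ⟨$⟩ʳ y → x ≡ y
⟨$⟩ʳ-injective σ eq = trans (sym (Perm.inverseˡ σ)) (trans (cong (σ ⟨$⟩ˡ_) eq) (Perm.inverseˡ σ))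

punchIn-<⇔ : (i : Fin (suc n)) {a b : Fin n} → punchIn i a F.< punchIn i b ⇔ a F.< b
punchIn-<⇔ i {a} {b} = mk⇔
  (λ lt → ℕ.≰⇒> (λ b≤a → ℕ.<⇒≱ lt (FP.punchIn-mono-≤ i b a b≤a)))
  (λ lt → ℕ.≰⇒> (λ le → ℕ.<⇒≱ lt (FP.punchIn-cancel-≤ i b a le)))

<-punchIn⇔ : (i : Fin (suc n)) (a : Fin n) → i F.< punchIn i a ⇔ i F.≤ a
<-punchIn⇔ zero    a       = mk⇔ (λ _ → z≤n) (λ _ → s≤s z≤n)
<-punchIn⇔ (suc i) zero    = mk⇔ (λ ()) (λ ())
<-punchIn⇔ (suc i) (suc a) = mk⇔
  (s≤s ∘ to (<-punchIn⇔ i a) ∘ s≤s⁻¹) (s≤s ∘ from (<-punchIn⇔ i a) ∘ s≤s⁻¹)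

punchIn-<⇔< : (i : Fin (suc n)) (a : Fin n) → punchIn i a F.< i ⇔ a F.< i
punchIn-<⇔< zero    a       = mk⇔ (λ ()) (λ ())
punchIn-<⇔< (suc i) zero    = mk⇔ (λ lt → lt) (λ lt → lt)
punchIn-<⇔< (suc i) (suc a) = mk⇔
  (s≤s ∘ to (punchIn-<⇔< i a) ∘ s≤s⁻¹) (s≤s ∘ from (punchIn-<⇔< i a) ∘ s≤s⁻¹)

opposite-<⇔ : (a b : Fin n) → opposite a F.< opposite b ⇔ b F.< a
opposite-<⇔ {n} a b = mk⇔
  (λ lt → ℕ.≰⇒> (λ a≤b → ℕ.<⇒≱ lt (opposite-≤ a≤b)))
  (λ lt → opposite-< (ℕ.∸-monoʳ-< (s≤s lt) (FP.toℕ<n a)))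
  where
  opposite-< : n ∸ suc (toℕ a) < n ∸ suc (toℕ b) → opposite a F.< opposite b
  opposite-< rewrite FP.opposite-prop a | FP.opposite-prop b = λ lt → lt
  opposite-≤ : a F.≤ b → opposite b F.≤ opposite a
  opposite-≤ a≤b rewrite FP.opposite-prop a | FP.opposite-prop b = ℕ.∸-monoʳ-≤ n (s≤s a≤b)

≻-asym : (σ : LinOrd n) {x y : Fin n} → x ≻[ σ ] y → ¬ (y ≻[ σ ] x)
≻-asym σ = ℕ.<-asym

≻-connex : (σ : LinOrd n) {x y : Fin n} → x ≢ y → x ≻[ σ ] y ⊎ y ≻[ σ ] x
≻-connex σ {x} {y} x≢y with FP.<-cmp (σ ⟨$⟩ʳ x) (σ ⟨$⟩ʳ y)
... | tri< lt _ _ = inj₁ lt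
... | tri≈ _ eq _ = ⊥-elim (x≢y (⟨$⟩ʳ-injective σ eq))
... | tri> _ _ gt = inj₂ gt

≻-revOrd : (σ : LinOrd n) {x y : Fin n} → x ≻[ revOrd σ ] y ⇔ y ≻[ σ ] x
≻-revOrd σ {x} {y} = opposite-<⇔ (σ ⟨$⟩ʳ x) (σ ⟨$⟩ʳ y)

≻-insert : (i : Fin (suc n)) (j : Fin (suc n)) (π : LinOrd n) {a b : Fin n} →
  punchIn i a ≻[ insert i j π ] punchIn i b ⇔ a ≻[ π ] b
≻-insert i j π {a} {b}
  rewrite Perm.insert-punchIn i j π a | Perm.insert-punchIn i j π b = punchIn-<⇔ j

⌊⌋-true : {A : Set} (a? : Dec A) → A → ⌊ a? ⌋ ≡ true
⌊⌋-true a? a = trans (isYes≗does a?) (dec-true a? a)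

⌊⌋-false : {A : Set} (a? : Dec A) → ¬ A → ⌊ a? ⌋ ≡ false
⌊⌋-false a? ¬a = trans (isYes≗does a?) (dec-false a? ¬a)

⌊⌋-⇔ : {A B : Set} → A ⇔ B → (a? : Dec A) (b? : Dec B) → ⌊ a? ⌋ ≡ ⌊ b? ⌋
⌊⌋-⇔ A⇔B a? b? = trans (isYes≗does a?) (trans (does-⇔ A⇔B a? b?) (sym (isYes≗does b?)))

countH-cong : {f g : Fin h → Bool} → (∀ i → f i ≡ g i) → countH f ≡ countH g
countH-cong {zero}  f≗g = refl
countH-cong {suc h} f≗g =
  cong₂ _+_ (cong (λ b → if b then 1 else 0) (f≗g zero)) (countH-cong (f≗g ∘ suc))

countH-true : {f : Fin h → Bool} → (∀ i → f i ≡ true) → countH f ≡ h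
countH-true {zero}  all-true = refl
countH-true {suc h} all-true rewrite all-true zero = cong suc (countH-true (all-true ∘ suc))

countH-false : {f : Fin h → Bool} → (∀ i → f i ≡ false) → countH f ≡ 0
countH-false {zero}  all-false = refl
countH-false {suc h} all-false rewrite all-false zero = countH-false (all-false ∘ suc)

support-cong : {m : ℕ} (p : Profile n h) (q : Profile m h) {y x : Fin n} {y′ x′ : Fin m} →
  (∀ i → y ≻[ p i ] x ⇔ y′ ≻[ q i ] x′) → support p y x ≡ support q y′ x′
support-cong p q {y} {x} {y′} {x′} same =
  countH-cong (λ i → ⌊⌋-⇔ (same i) (≻-dec (p i) y x) (≻-dec (q i) y′ x′))

support-self : (p : Profile n h) (x : Fin n) → support p x x ≡ 0
support-self p x = countH-false (λ i → ⌊⌋-false (≻-dec (p i) x x) (ℕ.<-irrefl refl))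

support-unanimous : (p : Profile n h) {y x : Fin n} → (∀ i → y ≻[ p i ] x) → support p y x ≡ h
support-unanimous p {y} {x} unanimous = countH-true (λ i → ⌊⌋-true (≻-dec (p i) y x) (unanimous i))

support-revProfile : (p : Profile n h) (y x : Fin n) → support (revProfile p) y x ≡ support p x y
support-revProfile p y x = support-cong (revProfile p) p (λ i → ≻-revOrd (p i))

support-≢ : (p : Profile n h) {y x : Fin n} → k < support p y x → y ≢ x
support-≢ p {x = x} lt refl = ℕ.n≮0 (subst (_ <_) (support-self p x) lt)

support-reversedPair : (σ : LinOrd n) (p : Profile n h) {y x : Fin n} → y ≢ x →
  support (σ ∷ revOrd σ ∷ p) y x ≡ suc (support p y x)
support-reversedPair σ p {y} {x} y≢x with ≻-connex σ y≢x
... | inj₁ y≻x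
  rewrite ⌊⌋-true (≻-dec σ y x) y≻x
        | ⌊⌋-false (≻-dec (revOrd σ) y x) (≻-asym σ y≻x ∘ to (≻-revOrd σ)) = refl
... | inj₂ x≻y
  rewrite ⌊⌋-false (≻-dec σ y x) (≻-asym σ x≻y)
        | ⌊⌋-true (≻-dec (revOrd σ) y x) (from (≻-revOrd σ) x≻y) = refl

record Pivotal (k : ℕ) (p : Profile n h) (c : Fin n) : Set where
  constructor mkPivotal
  field
    tied-against : ∀ y → y ≢ c → support p y c ≡ k
    tied-for     : ∀ y → y ≢ c → support p c y ≡ k
    defeated     : ∀ x → x ≢ c → ∃ λ y → k < support p y x
    defeats      : ∀ x → x ≢ c → ∃ λ z → k < support p x z

open Pivotal

PivotalProfile : (n h k : ℕ) → Fin n → Set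
PivotalProfile n h k c = Σ (Profile n h) λ p → Pivotal k p c

pivotal? : (k : ℕ) (p : Profile n h) (c : Fin n) → Dec (Pivotal k p c)
pivotal? k p c = map′
  (λ (against , for , beaten , beats) → mkPivotal against for beaten beats)
  (λ P → tied-against P , tied-for P , defeated P , defeats P)
  (FP.all? (λ y → ¬? (y FP.≟ c) →-dec support p y c ℕ.≟ k) ×-dec
   FP.all? (λ y → ¬? (y FP.≟ c) →-dec support p c y ℕ.≟ k) ×-dec
   FP.all? (λ x → ¬? (x FP.≟ c) →-dec FP.any? (λ y → k <? support p y x)) ×-dec
   FP.all? (λ x → ¬? (x FP.≟ c) →-dec FP.any? (λ z → k <? support p x z)))

pivotal-revProfile : {p : Profile n h} → Pivotal k p c → Pivotal k (revProfile p) c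
tied-against (pivotal-revProfile {p = p} P) y y≢c =
  trans (support-revProfile p y _) (tied-for P y y≢c)
tied-for (pivotal-revProfile {p = p} P) y y≢c =
  trans (support-revProfile p _ y) (tied-against P y y≢c)
defeated (pivotal-revProfile {p = p} P) x x≢c with defeats P x x≢c
... | z , lt = z , subst (_ <_) (sym (support-revProfile p z x)) lt
defeats (pivotal-revProfile {p = p} P) x x≢c with defeated P x x≢c
... | y , lt = y , subst (_ <_) (sym (support-revProfile p x y)) lt

pivotal-reversedPair : (σ : LinOrd n) {p : Profile n h} →
  Pivotal k p c → Pivotal (suc k) (σ ∷ revOrd σ ∷ p) c
tied-against (pivotal-reversedPair σ {p} P) y y≢c =
  trans (support-reversedPair σ p y≢c) (cong suc (tied-against P y y≢c))
tied-for (pivotal-reversedPair σ {p} P) y y≢c =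
  trans (support-reversedPair σ p (y≢c ∘ sym)) (cong suc (tied-for P y y≢c))
defeated (pivotal-reversedPair {k = k} σ {p} P) x x≢c with defeated P x x≢c
... | y , lt = y , subst (suc k <_) (sym (support-reversedPair σ p (support-≢ p lt))) (s≤s lt)
defeats (pivotal-reversedPair {k = k} σ {p} P) x x≢c with defeats P x x≢c
... | z , lt = z , subst (suc k <_) (sym (support-reversedPair σ p (support-≢ p lt))) (s≤s lt)

-- The clone is the new alternative 0, ranked right below the old alternative 0, which
-- becomes 1F; in general the old alternative a becomes suc a.
cloneFirst : LinOrd (suc n) → LinOrd (suc (suc n))
cloneFirst σ = insert zero (suc (σ ⟨$⟩ʳ zero)) σ

≻-cloneFirst-suc-suc : (σ : LinOrd (suc n)) {y x : Fin (suc n)} →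
  suc y ≻[ cloneFirst σ ] suc x ⇔ y ≻[ σ ] x
≻-cloneFirst-suc-suc σ = ≻-insert zero (suc (σ ⟨$⟩ʳ zero)) σ

≻-cloneFirst-zero-suc : (σ : LinOrd (suc n)) {x : Fin (suc n)} →
  zero ≻[ cloneFirst σ ] suc x ⇔ zero ≻[ σ ] x
≻-cloneFirst-zero-suc σ {x} = <-punchIn⇔ (suc (σ ⟨$⟩ʳ zero)) (σ ⟨$⟩ʳ x)

≻-cloneFirst-suc-zero : (σ : LinOrd (suc n)) {x : Fin (suc n)} → x ≢ zero →
  suc x ≻[ cloneFirst σ ] zero ⇔ x ≻[ σ ] zero
≻-cloneFirst-suc-zero σ {x} x≢0 = mk⇔
  (λ lt → FP.≤∧≢⇒< (s≤s⁻¹ (to below lt)) (x≢0 ∘ ⟨$⟩ʳ-injective σ))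
  (λ lt → from below (ℕ.m<n⇒m<1+n lt))
  where below = punchIn-<⇔< (suc (σ ⟨$⟩ʳ zero)) (σ ⟨$⟩ʳ x)

cloneFirst-1≻0 : (σ : LinOrd (suc n)) → 1F ≻[ cloneFirst σ ] 0F
cloneFirst-1≻0 σ = from (punchIn-<⇔< (suc (σ ⟨$⟩ʳ zero)) (σ ⟨$⟩ʳ zero)) (ℕ.n<1+n _)

pivotal-cloneFirst : {p : Profile (suc n) h} {c : Fin (suc n)} → c ≢ zero → k < h →
  Pivotal k p c → Pivotal k (cloneFirst ∘ p) (suc c)
pivotal-cloneFirst {k = k} {p = p} {c} c≢0 k<h P = mkPivotal against for beaten beats
  where
  q = cloneFirst ∘ p
  suc-suc : ∀ y x → support q (suc y) (suc x) ≡ support p y x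
  suc-suc y x = support-cong q p {suc y} {suc x} (λ i → ≻-cloneFirst-suc-suc (p i))
  zero-suc : ∀ x → support q zero (suc x) ≡ support p zero x
  zero-suc x = support-cong q p {zero} {suc x} {zero} {x} (λ i → ≻-cloneFirst-zero-suc (p i))
  suc-zero : ∀ y → y ≢ zero → support q (suc y) zero ≡ support p y zero
  suc-zero y y≢0 =
    support-cong q p {suc y} {zero} {y} {zero} (λ i → ≻-cloneFirst-suc-zero (p i) y≢0)
  suc≢ : ∀ {y} → suc y ≢ suc c → y ≢ c
  suc≢ sy≢sc = sy≢sc ∘ cong suc

  against : ∀ y → y ≢ suc c → support q y (suc c) ≡ k
  against zero    _   = trans (zero-suc c) (tied-against P zero (c≢0 ∘ sym))
  against (suc y) y≢c = trans (suc-suc y c) (tied-against P y (suc≢ y≢c))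
  for : ∀ y → y ≢ suc c → support q (suc c) y ≡ k
  for zero    _   = trans (suc-zero c c≢0) (tied-for P zero (c≢0 ∘ sym))
  for (suc y) y≢c = trans (suc-suc c y) (tied-for P y (suc≢ y≢c))
  beaten : ∀ x → x ≢ suc c → ∃ λ y → k < support q y x
  beaten zero _ = 1F , subst (_ <_) (sym (support-unanimous q {1F} {0F} (cloneFirst-1≻0 ∘ p))) k<h
  beaten (suc x) x≢c with defeated P x (suc≢ x≢c)
  ... | y , lt = suc y , subst (_ <_) (sym (suc-suc y x)) lt
  beats : ∀ x → x ≢ suc c → ∃ λ z → k < support q x z
  beats zero _ with defeats P zero (c≢0 ∘ sym)
  ... | z , lt = suc z , subst (_ <_) (sym (zero-suc z)) lt
  beats (suc x) x≢c with defeats P x (suc≢ x≢c)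
  ... | z , lt = suc z , subst (_ <_) (sym (suc-suc x z)) lt

lastOnTop lastAtBottom : LinOrd n → LinOrd (suc n)
lastOnTop    {n} π = insert (fromℕ n) zero π
lastAtBottom {n} π = insert (fromℕ n) (fromℕ n) π

-- rotation r ranks the alternatives r > r+1 > ... cyclically.
rotation : ℕ → LinOrd (suc n)
rotation     zero    = Perm.id
rotation {n} (suc r) = rotation r ∘ₚ insert zero (fromℕ n) Perm.id

condorcet₄ : Profile 4 6
condorcet₄ = lastOnTop (rotation 0) ∷ lastOnTop (rotation 1) ∷ lastOnTop (rotation 2) ∷
             lastAtBottom (rotation 0) ∷ lastAtBottom (rotation 1) ∷ lastAtBottom (rotation 2) ∷ []

condorcet₅ : Profile 5 4
condorcet₅ = lastOnTop (rotation 0) ∷ lastOnTop (rotation 1) ∷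
             lastAtBottom (rotation 2) ∷ lastAtBottom (rotation 3) ∷ []

pivotal-condorcet₄ : Pivotal 3 condorcet₄ 3F
pivotal-condorcet₄ = from-yes (pivotal? 3 condorcet₄ 3F)

pivotal-condorcet₅ : Pivotal 2 condorcet₅ 4F
pivotal-condorcet₅ = from-yes (pivotal? 2 condorcet₅ 4F)

reversedPair : PivotalProfile n h k c → PivotalProfile n (2 + h) (suc k) c
reversedPair (p , P) = Perm.id ∷ revOrd Perm.id ∷ p , pivotal-reversedPair Perm.id P

pivotal₄ : ∀ e → PivotalProfile 4 ((3 + e) * 2) (3 + e) 3F
pivotal₄ zero    = condorcet₄ , pivotal-condorcet₄
pivotal₄ (suc e) = reversedPair (pivotal₄ e)

pivotal₅₊ : ∀ j e → PivotalProfile (5 + j) ((2 + e) * 2) (2 + e) (fromℕ (4 + j))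
pivotal₅₊ zero    zero    = condorcet₅ , pivotal-condorcet₅
pivotal₅₊ zero    (suc e) = reversedPair (pivotal₅₊ zero e)
pivotal₅₊ (suc j) e with pivotal₅₊ j e
... | p , P = cloneFirst ∘ p , pivotal-cloneFirst (λ ()) (ℕ.m<m*n (2 + e) 2 (s≤s (s≤s z≤n))) P

pivot-inD : {p : Profile n h} → Pivotal k p c → InD (suc k) p c
pivot-inD {c = c} {p = p} P y with y FP.≟ c
... | yes refl = subst (_< _) (sym (support-self p c)) (s≤s z≤n)
... | no y≢c   = ℕ.≤-reflexive (cong suc (tied-against P y y≢c))

inD⇒pivot : {p : Profile n h} → Pivotal k p c → ∀ x → InD (suc k) p x → x ≡ c
inD⇒pivot {c = c} P x x∈D with x FP.≟ c
... | yes x≡c = x≡c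
... | no x≢c with defeated P x x≢c
...   | y , lt = ⊥-elim (ℕ.<⇒≱ lt (s≤s⁻¹ (x∈D y)))

admissible-suc : ∀ k → Admissible (suc k * 2) (2 + k)
admissible-suc k =
  subst (suc k * 2 <_) (ℕ.*-comm (2 + k) 2) (ℕ.m<n+m (suc k * 2) {2} (s≤s z≤n)) ,
  s≤s (s≤s (ℕ.m≤m*n k 2))

admissible⇒> : ∀ {μ} → Admissible (k * 2) μ → k < μ
admissible⇒> {k} {μ} (k*2<2*μ , _) = ℕ.*-cancelʳ-< 2 k μ (subst (k * 2 <_) (ℕ.*-comm 2 μ) k*2<2*μ)

uniqueWinner : (p : Profile n (suc k * 2)) → Pivotal (suc k) p c →
  ∃ λ μ → IsMu p μ × (∀ x → InD μ p x ⇔ x ≡ c)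
uniqueWinner {k = k} {c = c} p P =
  2 + k ,
  (admissible-suc k , (c , pivot-inD P) , λ _ adm _ → admissible⇒> adm) ,
  λ x → mk⇔ (inD⇒pivot P x) (λ { refl → pivot-inD P })

uniqueWinners : PivotalProfile n (suc k * 2) (suc k) c →
  Σ (Profile n (suc k * 2)) λ p →
    (∃ λ μ → IsMu p μ × (∀ x → InD μ p x ⇔ x ≡ c)) ×
    (∃ λ μ → IsMu (revProfile p) μ × (∀ x → InD μ (revProfile p) x ⇔ x ≡ c))
uniqueWinners (p , P) = p , uniqueWinner p P , uniqueWinner (revProfile p) (pivotal-revProfile P)

proposition24 : (m h : ℕ) → 4 ≤ suc m → 2 ∣ h → 2 * m ≤ h * (suc m ∸ 3) →
    Σ (Profile (suc m) h) λ p →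
      (∃ λ μ → IsMu p μ × (∀ x → InD μ p x ⇔ x ≡ fromℕ m)) ×
      (∃ λ μ → IsMu (revProfile p) μ × (∀ x → InD μ (revProfile p) x ⇔ x ≡ fromℕ m))
proposition24 0 _ (s≤s ()) _ _
proposition24 1 _ (s≤s (s≤s ())) _ _
proposition24 2 _ (s≤s (s≤s (s≤s ()))) _ _
proposition24 3 _ _ (divides 0 refl) ()
proposition24 3 _ _ (divides 1 refl) (s≤s (s≤s ()))
proposition24 3 _ _ (divides 2 refl) (s≤s (s≤s (s≤s (s≤s ()))))
proposition24 3 _ _ (divides (suc (suc (suc e))) refl) _ = uniqueWinners {k = 2 + e} (pivotal₄ e)
proposition24 (suc (suc (suc (suc j)))) _ _ (divides 0 refl) ()
proposition24 (suc (suc (suc (suc j)))) _ _ (divides 1 refl) 2[4+j]≤2[2+j] =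
  ⊥-elim (ℕ.<⇒≱ (ℕ.m<n+m (2 + j) {2} (s≤s z≤n)) (ℕ.*-cancelˡ-≤ 2 2[4+j]≤2[2+j]))
proposition24 (suc (suc (suc (suc j)))) _ _ (divides (suc (suc e)) refl) _ =
  uniqueWinners {k = suc e} (pivotal₅₊ j e)
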